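{- Let $\mathcal{G}$ be a finite simple undirected graph and let $H_1$, $H_2$ be T-twins in $\mathcal{G}$ with vertex sets $V_1$, $V_2$. Then the three sets $V_1\cap V_2$, $V_1-V_2$ and $V_2-V_1$ are pairwise fully connected, i.e., for any two of these sets, every vertex of one is adjacent to every vertex of the other.
   Context: All graphs are finite, undirected, without loops or parallel edges. For a vertex $u$, $\mathcal{N}(u)$ denotes the set of vertices adjacent to $u$. Two induced subgraphs $H_1,H_2$ of $\mathcal{G}$ with vertex sets $V_1,V_2$ are called T-twins if there is a graph isomorphism $\varphi:V_1\to V_2$ between $H_1$ and $H_2$ such that $\mathcal{N}(u)\cup V_1=\mathcal{N}(\varphi(u))\cup V_2$ for all $u\in V_1$. -}

module Defs where

open import Level using (0ℓ)
open import Data.Nat using (ℕ)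
open import Data.Fin using (Fin)
open import Data.Fin.Subset using (Subset; _∈_)
open import Data.Product using (Σ; _×_; proj₁)
open import Data.Sum using (_⊎_)
open import Relation.Nullary using (¬_)
open import Relation.Binary.PropositionalEquality using (_≡_)
open import Function.Bundles using (_⤖_; _⇔_; Bijection)

record SimpleGraph (n : ℕ) : Set₁ where
  field
    Adj     : Fin n → Fin n → Set
    symm    : ∀ {x y} → Adj x y → Adj y x
    irrefl  : ∀ {x} → ¬ Adj x x

open SimpleGraph public

Elt : {n : ℕ} → Subset n → Set
Elt {n} V = Σ (Fin n) (λ x → x ∈ V)

record InducedIso {n : ℕ} (G : SimpleGraph n) (V₁ V₂ : Subset n) : Set where
  field
    φ       : Elt V₁ ⤖ Elt V₂
    adj-iff : ∀ (a b : Elt V₁) →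
              Adj G (proj₁ a) (proj₁ b) ⇔
              Adj G (proj₁ (Bijection.to φ a)) (proj₁ (Bijection.to φ b))

-- H₁ = G[V₁] and H₂ = G[V₂] are T-twins: there is an isomorphism φ with
-- N(u) ∪ V₁ = N(φ(u)) ∪ V₂ for all u ∈ V₁.
record TTwins {n : ℕ} (G : SimpleGraph n) (V₁ V₂ : Subset n) : Set where
  field
    iso   : InducedIso G V₁ V₂
    nbhd  : ∀ (u : Elt V₁) (w : Fin n) →
            (Adj G (proj₁ u) w ⊎ w ∈ V₁) ⇔
            (Adj G (proj₁ (Bijection.to (InducedIso.φ iso) u)) w ⊎ w ∈ V₂)

FullyConnected : {n : ℕ} → SimpleGraph n → Subset n → Subset n → Set
FullyConnected G A B = ∀ x y → x ∈ A → y ∈ B → Adj G x y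

module Submission where

open import Defs
open import Data.Nat using (ℕ)
open import Data.Fin using (Fin; zero)
open import Data.Fin.Subset using (Subset; _∩_; _─_; _∈_; _∉_; inside; outside)
open import Data.Fin.Subset.Properties using (x∈p∩q⁻)
open import Data.Product using (_×_; _,_; proj₁)
open import Data.Sum using (_⊎_; inj₂; fromInj₁)
open import Data.Vec using (_∷_; here; there)
open import Relation.Nullary using (¬_)
open import Relation.Nullary.Negation using (contradiction)
open import Relation.Binary.PropositionalEquality using (subst)
open import Function.Bundles using (Bijection; Equivalence)

x∈p─q⁻ : ∀ {n} (p q : Subset n) {x : Fin n} → x ∈ p ─ q → x ∈ p × x ∉ q
x∈p─q⁻ (inside  ∷ p) (outside ∷ q) here      = here , λ ()
x∈p─q⁻ (_       ∷ p) (inside  ∷ q) {zero} ()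
x∈p─q⁻ (outside ∷ p) (outside ∷ q) {zero} ()
x∈p─q⁻ (_       ∷ p) (_       ∷ q) (there x) with x∈p─q⁻ p q x
... | x∈p , x∉q = there x∈p , λ { (there x∈q) → x∉q x∈q }

resolveˡ : ∀ {a b} {A : Set a} {B : Set b} → ¬ B → A ⊎ B → A
resolveˡ ¬b = fromInj₁ (λ b → contradiction b ¬b)

module _ {n : ℕ} {G : SimpleGraph n} {V₁ V₂ : Subset n} (twins : TTwins G V₁ V₂) where

  open TTwins twins
  open Bijection (InducedIso.φ iso) using (strictlySurjective)

  -- N(x) ∪ V₁ = N(φ x) ∪ V₂ contains V₂, so a vertex outside V₁ in it lies in N(x).
  V₁-adj-V₂─V₁ : ∀ {x y} → x ∈ V₁ → y ∈ V₂ → y ∉ V₁ → Adj G x y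
  V₁-adj-V₂─V₁ {x} {y} x∈V₁ y∈V₂ y∉V₁ =
    resolveˡ y∉V₁ (Equivalence.from (nbhd (x , x∈V₁) y) (inj₂ y∈V₂))

  -- Dually, writing x ∈ V₂ as φ u, the set N(u) ∪ V₁ contains V₁.
  V₂-adj-V₁─V₂ : ∀ {x y} → x ∈ V₂ → y ∈ V₁ → y ∉ V₂ → Adj G x y
  V₂-adj-V₁─V₂ {x} {y} x∈V₂ y∈V₁ y∉V₂ with strictlySurjective (x , x∈V₂)
  ... | u , φu≡x = subst (λ z → Adj G (proj₁ z) y) φu≡x
    (resolveˡ y∉V₂ (Equivalence.to (nbhd u y) (inj₂ y∈V₁)))

proposition7 : ∀ {n : ℕ} (G : SimpleGraph n) (V₁ V₂ : Subset n) →
    TTwins G V₁ V₂ →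
    FullyConnected G (V₁ ∩ V₂) (V₁ ─ V₂) ×
    FullyConnected G (V₁ ∩ V₂) (V₂ ─ V₁) ×
    FullyConnected G (V₁ ─ V₂) (V₂ ─ V₁)
proposition7 G V₁ V₂ twins = ∩-adj-V₁─V₂ , ∩-adj-V₂─V₁ , V₁─V₂-adj-V₂─V₁
  where
  ∩-adj-V₁─V₂ : FullyConnected G (V₁ ∩ V₂) (V₁ ─ V₂)
  ∩-adj-V₁─V₂ x y x∈∩ y∈─ with x∈p∩q⁻ V₁ V₂ x∈∩ | x∈p─q⁻ V₁ V₂ y∈─
  ... | _ , x∈V₂ | y∈V₁ , y∉V₂ = V₂-adj-V₁─V₂ twins x∈V₂ y∈V₁ y∉V₂

  ∩-adj-V₂─V₁ : FullyConnected G (V₁ ∩ V₂) (V₂ ─ V₁)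
  ∩-adj-V₂─V₁ x y x∈∩ y∈─ with x∈p∩q⁻ V₁ V₂ x∈∩ | x∈p─q⁻ V₂ V₁ y∈─
  ... | x∈V₁ , _ | y∈V₂ , y∉V₁ = V₁-adj-V₂─V₁ twins x∈V₁ y∈V₂ y∉V₁

  V₁─V₂-adj-V₂─V₁ : FullyConnected G (V₁ ─ V₂) (V₂ ─ V₁)
  V₁─V₂-adj-V₂─V₁ x y x∈─ y∈─ with x∈p─q⁻ V₁ V₂ x∈─ | x∈p─q⁻ V₂ V₁ y∈─
  ... | x∈V₁ , _ | y∈V₂ , y∉V₁ = V₁-adj-V₂─V₁ twins x∈V₁ y∈V₂ y∉V₁
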